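{- There exists $\varepsilon>0$ such that for every positive integer $k$, $\operatorname{sat}(k)\le 2^{(1-\varepsilon)k}$.
   Context: For a set $X$, a collection $\mathcal{F}\subseteq\mathcal{P}(X)$ is a $k$-Sperner system if it contains no $(k+1)$-chain, i.e. no sets $A_1\subsetneq A_2\subsetneq\dots\subsetneq A_{k+1}$ all in $\mathcal{F}$. It is a saturated $k$-Sperner system if it is a $k$-Sperner system and for every $S\in\mathcal{P}(X)\setminus\mathcal{F}$ the collection $\mathcal{F}\cup\{S\}$ contains a $(k+1)$-chain. $\operatorname{sat}(n,k)$ denotes the minimum size of a saturated $k$-Sperner system in $\mathcal{P}(X)$ with $|X|=n$. For fixed $k$, $\operatorname{sat}(n,k)$ is constant for all sufficiently large $n$, and $\operatorname{sat}(k):=\lim_{n\to\infty}\operatorname{sat}(n,k)$. -}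

module Defs where

open import Data.Nat using (ℕ; suc)
open import Data.Fin using (Fin; inject₁)
import Data.Fin as F
open import Data.Fin.Subset using (Subset; _⊂_)
open import Data.List using (List; _∷_; length)
open import Data.List.Membership.Propositional using (_∈_; _∉_)
open import Data.List.Relation.Unary.Unique.Propositional using (Unique)
open import Data.Product using (Σ; ∃; _×_)
open import Relation.Nullary using (¬_)

-- The ground set X is Fin n; subsets of X are Subset n.
-- A family 𝓕 ⊆ P(X) is a duplicate-free list of subsets; its size is its length.

HasChain : {n : ℕ} → (k : ℕ) → List (Subset n) → Set
HasChain {n} k 𝓕 =
  Σ (Fin (suc k) → Subset n) λ A →
    (∀ i → A i ∈ 𝓕) × (∀ (i : Fin k) → A (inject₁ i) ⊂ A (F.suc i))

IsSperner : {n : ℕ} → ℕ → List (Subset n) → Set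
IsSperner k 𝓕 = ¬ HasChain k 𝓕

IsSaturated : {n : ℕ} → ℕ → List (Subset n) → Set
IsSaturated {n} k 𝓕 =
  IsSperner k 𝓕 × (∀ (S : Subset n) → S ∉ 𝓕 → HasChain k (S ∷ 𝓕))

-- "sat(n,k) ≤ m": some saturated k-Sperner system in P([n]) has size ≤ m
-- (equivalent to the minimum being ≤ m).
SatAtMost : ℕ → ℕ → (ℕ → Set) → Set
SatAtMost n k P =
  Σ (List (Subset n)) λ 𝓕 → Unique 𝓕 × IsSaturated k 𝓕 × P (length 𝓕)

module Submission where

-- A scaffold of height j on a ground set [m] is a pair of families 𝒜, ℬ ⊆ P([m]) with gradings
-- α, β = j − α : P([m]) → ℕ such that every C ⊆ [m] lies above a strict 𝒜-chain of length
-- α(C) + 1 and below a strict ℬ-chain of length β(C) + 1, while α increases strictly along 𝒜 and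
-- along ℬ and weakly from 𝒜 to ℬ.  Adding a block W of new points, {A : A ∈ 𝒜} ∪ {B ∪ W : B ∈ ℬ}
-- is a saturated (j + 2)-Sperner system on [m] ∪ W: ranking A by α(A) and B ∪ W by α(B) + 1
-- bounds every chain, and any other set C ∪ W′ fits between the 𝒜-chain and the ℬ-chain over C.
-- Scaffolds multiply (𝒜₁ × 𝒜₂ and ℬ₁ × ℬ₂, graded by α₁ + α₂, have height j₁ + j₂), and a
-- computer-checked scaffold of height 4 on 6 points with |𝒜| = |ℬ| = 15 gives saturated
-- k-Sperner systems of size 2 · 15^(k/4 + O(1)) ≤ 2^((1 − 1/43) k), as 15^43 ≤ 2^168.

open import Defs
open import Data.Nat using (ℕ; _≤_; _<_; _^_; _*_; _∸_)
open import Data.Product using (Σ; _×_)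

open import Algebra.Properties.CommutativeSemigroup using (interchange)
import Data.Bool.Properties as Bool
open import Data.Bool.ListAction using (any)
open import Data.Fin using (Fin; zero; suc; inject₁; toℕ; fromℕ)
open import Data.Fin.Properties using (toℕ-fromℕ)
open import Data.Fin.Subset using (Subset; _⊆_; _⊂_; _⊇_; _⊃_; ⊥; ⊤; ∣_∣; inside; outside)
open import Data.Fin.Subset.Properties
  using (⊆-refl; ⊆-trans; ⊆-min; ⊆-max; p⊂q⇒p⊆q; ⊂-irref; drop-∷-⊆; out⊆; in⊆in; out⊂; out⊂in; in⊂in;
         _⊆?_; _⊂?_)
open import Data.List as List using (List; []; _∷_; length; lookup; map; reverse; filter; foldr; cartesianProductWith)
open import Data.List.Base using (reverseAcc)
open import Data.List.Properties using (length-++; length-map; length-reverse)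
open import Data.List.Membership.Propositional using (_∈_; _∉_; find; lose)
open import Data.List.Membership.Propositional.Properties
  using (∈-lookup; ∈-map⁺; ∈-map⁻; ∈-++⁺ˡ; ∈-++⁺ʳ; ∈-++⁻; ∈-cartesianProductWith⁺; ∈-cartesianProductWith⁻)
open import Data.List.Relation.Unary.All as All using (All; []; _∷_; all?)
import Data.List.Relation.Unary.All.Properties as All
open import Data.List.Relation.Unary.AllPairs using ([]; _∷_)
open import Data.List.Relation.Unary.Any using (here; there; any?)
open import Data.List.Relation.Unary.Linked as Linked using (Linked; []; [-]; _∷_)
import Data.List.Relation.Unary.Linked.Properties as Linked
open import Data.List.Relation.Unary.Unique.Propositional using (Unique)
import Data.List.Relation.Unary.Unique.Propositional.Properties as Unique
import Data.List.Relation.Unary.Unique.DecPropositional as UniqueDec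
open import Data.Nat using (zero; suc; _+_; _⊔_; _≟_; _≤?_; _<?_; _≡ᵇ_; z≤n; s≤s)
open import Data.Nat.Properties
  using (≤-refl; ≤-trans; ≤-<-trans; <-irrefl; <⇒≤; m≤m+n; m≤n⇒m≤1+n; m∸n+n≡m; m+[n∸m]≡n;
         +-suc; +-identityʳ; +-mono-≤; +-mono-<-≤; +-mono-≤-<; *-mono-≤; *-assoc; *-comm;
         *-distribˡ-+; ^-distribˡ-+-*; ^-monoˡ-≤; suc-injective;
         +-commutativeSemigroup; *-commutativeSemigroup)
open import Data.Product using (∃-syntax; ∃₂; _,_; proj₁; proj₂; uncurry)
open import Data.Sum using (_⊎_; inj₁; inj₂)
open import Data.Unit using (tt)
open import Data.Vec using (Vec; []; _∷_; _++_; take; drop; tabulate)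
import Data.Vec as Vec
open import Data.Vec.Properties using (++-injectiveˡ; ++-injectiveʳ; take++drop≡id; ≡-dec)
open import Function using (_∘_; flip)
open import Level using (0ℓ)
open import Relation.Binary.Core using (Rel)
open import Relation.Binary.Definitions using (Decidable; DecidableEquality)
open import Relation.Binary.PropositionalEquality
  using (_≡_; _≢_; refl; sym; trans; subst; subst₂; cong; cong₂; module ≡-Reasoning)
open import Relation.Nullary using (¬_; Dec; yes; no; contradiction; map′; _×-dec_; _→-dec_)
open import Relation.Nullary.Decidable using (True; toWitness)
import Relation.Unary as U

private variable
  A : Set
  R : Rel A 0ℓ
  j j₁ j₂ k m m₁ m₂ n : ℕ

-- Subsets of a disjoint union

infix 4 _≟ₛ_
_≟ₛ_ : DecidableEquality (Subset n)
_≟ₛ_ = ≡-dec Bool._≟_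

⊂⇒≢ : {p q : Subset n} → p ⊂ q → p ≢ q
⊂⇒≢ p⊂q p≡q = ⊂-irref p≡q p⊂q

⊆∧≢⇒⊂ : {p q : Subset n} → p ⊆ q → p ≢ q → p ⊂ q
⊆∧≢⇒⊂ {p = []}          {[]}          _   p≢q = contradiction refl p≢q
⊆∧≢⇒⊂ {p = outside ∷ p} {outside ∷ q} p⊆q p≢q = out⊂ (⊆∧≢⇒⊂ (drop-∷-⊆ p⊆q) (p≢q ∘ cong (outside ∷_)))
⊆∧≢⇒⊂ {p = outside ∷ p} {inside ∷ q}  p⊆q _   = out⊂in (drop-∷-⊆ p⊆q)
⊆∧≢⇒⊂ {p = inside ∷ p}  {outside ∷ q} p⊆q _   with p⊆q Vec.here
... | ()
⊆∧≢⇒⊂ {p = inside ∷ p}  {inside ∷ q}  p⊆q p≢q = in⊂in (⊆∧≢⇒⊂ (drop-∷-⊆ p⊆q) (p≢q ∘ cong (inside ∷_)))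

⊆⇒≡⊎⊂ : {p q : Subset n} → p ⊆ q → p ≡ q ⊎ p ⊂ q
⊆⇒≡⊎⊂ {p = p} {q} p⊆q with p ≟ₛ q
... | yes p≡q = inj₁ p≡q
... | no  p≢q = inj₂ (⊆∧≢⇒⊂ p⊆q p≢q)

++⁺-⊆ : {p q : Subset m} {r s : Subset n} → p ⊆ q → r ⊆ s → p ++ r ⊆ q ++ s
++⁺-⊆ {p = []}          {[]}          _   r⊆s = r⊆s
++⁺-⊆ {p = outside ∷ p} {_ ∷ q}       p⊆q r⊆s = out⊆ (++⁺-⊆ (drop-∷-⊆ p⊆q) r⊆s)
++⁺-⊆ {p = inside ∷ p}  {inside ∷ q}  p⊆q r⊆s = in⊆in (++⁺-⊆ (drop-∷-⊆ p⊆q) r⊆s)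
++⁺-⊆ {p = inside ∷ p}  {outside ∷ q} p⊆q _   with p⊆q Vec.here
... | ()

++⁻-⊆ : (p q : Subset m) {r s : Subset n} → p ++ r ⊆ q ++ s → p ⊆ q × r ⊆ s
++⁻-⊆ []            []            p++r⊆q++s = (λ ()) , p++r⊆q++s
++⁻-⊆ (outside ∷ p) (_ ∷ q)       p++r⊆q++s with ++⁻-⊆ p q (drop-∷-⊆ p++r⊆q++s)
... | p⊆q , r⊆s = out⊆ p⊆q , r⊆s
++⁻-⊆ (inside ∷ p)  (inside ∷ q)  p++r⊆q++s with ++⁻-⊆ p q (drop-∷-⊆ p++r⊆q++s)
... | p⊆q , r⊆s = in⊆in p⊆q , r⊆s
++⁻-⊆ (inside ∷ p)  (outside ∷ q) p++r⊆q++s with p++r⊆q++s Vec.here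
... | ()

++⁺ˡ-⊂ : {p q : Subset m} {r s : Subset n} → p ⊂ q → r ⊆ s → p ++ r ⊂ q ++ s
++⁺ˡ-⊂ {p = p} {q} p⊂q r⊆s = ⊆∧≢⇒⊂ (++⁺-⊆ (p⊂q⇒p⊆q p⊂q) r⊆s) (⊂⇒≢ p⊂q ∘ ++-injectiveˡ p q)

++⁺ʳ-⊂ : {p q : Subset m} {r s : Subset n} → p ⊆ q → r ⊂ s → p ++ r ⊂ q ++ s
++⁺ʳ-⊂ {p = p} {q} p⊆q r⊂s = ⊆∧≢⇒⊂ (++⁺-⊆ p⊆q (p⊂q⇒p⊆q r⊂s)) (⊂⇒≢ r⊂s ∘ ++-injectiveʳ p q)

++⁻-⊂ : (p q : Subset m) {r s : Subset n} → p ++ r ⊂ q ++ s → p ⊂ q × r ⊆ s ⊎ p ⊆ q × r ⊂ s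
++⁻-⊂ p q p++r⊂q++s with ++⁻-⊆ p q (p⊂q⇒p⊆q p++r⊂q++s) | p ≟ₛ q
... | p⊆q , r⊆s | no p≢q = inj₁ (⊆∧≢⇒⊂ p⊆q p≢q , r⊆s)
... | p⊆q , r⊆s | yes refl = inj₂ (p⊆q , ⊆∧≢⇒⊂ r⊆s (⊂⇒≢ p++r⊂q++s ∘ cong (p ++_)))

take-++ : (xs : Vec A m) (ys : Vec A n) → take m (xs ++ ys) ≡ xs
take-++ {m = m} xs ys = ++-injectiveˡ _ xs (take++drop≡id m (xs ++ ys))

drop-++ : (xs : Vec A m) (ys : Vec A n) → drop m (xs ++ ys) ≡ ys
drop-++ {m = m} xs ys = ++-injectiveʳ (take m (xs ++ ys)) xs (take++drop≡id m (xs ++ ys))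

-- Chains

Linked-lookup : ∀ {x xs} → Linked R (x ∷ xs) →
                (i : Fin (length xs)) → R (lookup (x ∷ xs) (inject₁ i)) (lookup (x ∷ xs) (suc i))
Linked-lookup (r ∷ _)  zero    = r
Linked-lookup (_ ∷ rs) (suc i) = Linked-lookup rs i

linked⇒HasChain : {𝓕 : List (Subset n)} (xs : List (Subset n)) → length xs ≡ suc k →
                  All (_∈ 𝓕) xs → Linked _⊂_ xs → HasChain k 𝓕
linked⇒HasChain (x ∷ xs) refl xs⊆𝓕 xs↗ =
  lookup (x ∷ xs) , (λ i → All.lookup xs⊆𝓕 (∈-lookup i)) , Linked-lookup xs↗

increasing⇒toℕ≤ : (f : Fin (suc k) → ℕ) → (∀ i → f (inject₁ i) < f (suc i)) → ∀ i → toℕ i ≤ f i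
increasing⇒toℕ≤         f f↗ zero    = z≤n
increasing⇒toℕ≤ {suc k} f f↗ (suc i) =
  ≤-<-trans (increasing⇒toℕ≤ (f ∘ inject₁) (f↗ ∘ inject₁) i) (f↗ i)

rank⇒IsSperner : {𝓕 : List (Subset n)} (rank : Subset n → ℕ) →
                 (∀ {S} → S ∈ 𝓕 → rank S < k) →
                 (∀ {S T} → S ∈ 𝓕 → T ∈ 𝓕 → S ⊂ T → rank S < rank T) →
                 IsSperner k 𝓕
rank⇒IsSperner {k = k} rank rank<k rank↗ (A , A∈𝓕 , A↗) = <-irrefl refl (≤-<-trans k≤rank (rank<k (A∈𝓕 (fromℕ k))))
  where
  k≤rank : k ≤ rank (A (fromℕ k))
  k≤rank = subst (_≤ rank (A (fromℕ k))) (toℕ-fromℕ k)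
    (increasing⇒toℕ≤ (rank ∘ A) (λ i → rank↗ (A∈𝓕 _) (A∈𝓕 _) (A↗ i)) (fromℕ k))

Linked-reverseAcc : ∀ {x acc xs} → Linked (flip R) (x ∷ acc) → Linked R (x ∷ xs) →
                    Linked (flip R) (reverseAcc (x ∷ acc) xs)
Linked-reverseAcc acc↘ [-]       = acc↘
Linked-reverseAcc acc↘ (r ∷ xs↗) = Linked-reverseAcc (r ∷ acc↘) xs↗

Linked-reverse : ∀ {xs} → Linked R xs → Linked (flip R) (reverse xs)
Linked-reverse []        = []
Linked-reverse [-]       = [-]
Linked-reverse (r ∷ xs↗) = Linked-reverseAcc (r ∷ [-]) xs↗

All-reverseAcc : ∀ {P : A → Set} {acc} xs → All P acc → All P xs → All P (reverseAcc acc xs)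
All-reverseAcc []       acc []         = acc
All-reverseAcc (x ∷ xs) acc (px ∷ pxs) = All-reverseAcc xs (px ∷ acc) pxs

All-reverse : ∀ {P : A → Set} {xs} → All P xs → All P (reverse xs)
All-reverse {xs = xs} = All-reverseAcc xs []

Linked-++-∷ : ∀ {xs s ys} → Linked R xs → All (flip R s) xs → All (R s) ys → Linked R ys →
              Linked R (xs List.++ s ∷ ys)
Linked-++-∷ []        []       []       []  = [-]
Linked-++-∷ []        []       (r ∷ _)  ys↗ = r ∷ ys↗
Linked-++-∷ [-]       (r ∷ []) rs       ys↗ = r ∷ Linked-++-∷ [] [] rs ys↗
Linked-++-∷ (r ∷ xs↗) (_ ∷ rs) rs′      ys↗ = r ∷ Linked-++-∷ xs↗ rs rs′ ys↗

record Graded {m} (_≼_ _≺_ : Rel (Subset m) 0ℓ) (𝒳 : List (Subset m)) (ρ : Subset m → ℕ) : Set where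
  field
    cover : ∀ C → ∃[ X ] X ∈ 𝒳 × X ≼ C × ρ X ≡ ρ C
    step  : ∀ {X} → X ∈ 𝒳 → 0 < ρ X → ∃[ Y ] Y ∈ 𝒳 × Y ≺ X × suc (ρ Y) ≡ ρ X

record ChainIn {m} (P : Subset m → Set) (R : Rel (Subset m) 0ℓ) (ℓ : ℕ) : Set where
  field
    sets    : List (Subset m)
    length≡ : length sets ≡ ℓ
    members : All P sets
    linked  : Linked R sets

module _ {_≼_ _≺_ : Rel (Subset m) 0ℓ} {𝒳 : List (Subset m)} {ρ : Subset m → ℕ}
         (graded : Graded _≼_ _≺_ 𝒳 ρ) (≺-≼-trans : ∀ {X Y C} → Y ≺ X → X ≼ C → Y ≼ C) where

  open Graded graded

  private
    descent : ∀ t {C X} → X ∈ 𝒳 → X ≼ C → ρ X ≡ t →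
              Σ (List (Subset m)) λ ys → length ys ≡ t ×
                All (λ Y → Y ∈ 𝒳 × Y ≼ C) (X ∷ ys) × Linked (flip _≺_) (X ∷ ys)
    descent zero    X∈𝒳 X≼C _      = [] , refl , (X∈𝒳 , X≼C) ∷ [] , [-]
    descent (suc t) X∈𝒳 X≼C ρX≡1+t with step X∈𝒳 (subst (0 <_) (sym ρX≡1+t) (s≤s z≤n))
    ... | Y , Y∈𝒳 , Y≺X , 1+ρY≡ρX with descent t Y∈𝒳 (≺-≼-trans Y≺X X≼C) (suc-injective (trans 1+ρY≡ρX ρX≡1+t))
    ...   | ys , |ys|≡t , ys∈ , ys↘ = Y ∷ ys , cong suc |ys|≡t , (X∈𝒳 , X≼C) ∷ ys∈ , Y≺X ∷ ys↘

  graded-chain : ∀ C → ChainIn (λ X → X ∈ 𝒳 × X ≼ C) (flip _≺_) (suc (ρ C))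
  graded-chain C with cover C
  ... | X , X∈𝒳 , X≼C , ρX≡ρC with descent (ρ C) X∈𝒳 X≼C ρX≡ρC
  ...   | ys , |ys|≡ρC , ys∈ , ys↘ = record
    { sets = X ∷ ys ; length≡ = cong suc |ys|≡ρC ; members = ys∈ ; linked = ys↘ }

-- Scaffolds

StrictlyMonotoneOn : List (Subset m) → (Subset m → ℕ) → Set
StrictlyMonotoneOn 𝒳 ρ = ∀ {X} → X ∈ 𝒳 → ∀ {Y} → Y ∈ 𝒳 → X ⊂ Y → ρ X < ρ Y

record Scaffold (j m : ℕ) : Set where
  field
    𝒜 ℬ        : List (Subset m)
    𝒜-unique   : Unique 𝒜
    ℬ-unique   : Unique ℬ
    α β        : Subset m → ℕ
    α+β≡j      : ∀ C → α C + β C ≡ j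
    𝒜-graded   : Graded _⊆_ _⊂_ 𝒜 α
    ℬ-graded   : Graded _⊇_ _⊃_ ℬ β
    α-strict-𝒜 : StrictlyMonotoneOn 𝒜 α
    α-strict-ℬ : StrictlyMonotoneOn ℬ α
    α-mono-𝒜ℬ  : ∀ {A} → A ∈ 𝒜 → ∀ {B} → B ∈ ℬ → A ⊆ B → α A ≤ α B

  size : ℕ
  size = length 𝒜 + length ℬ

  α≤j : ∀ C → α C ≤ j
  α≤j C = subst (α C ≤_) (α+β≡j C) (m≤m+n (α C) (β C))

module FromScaffold (S : Scaffold j m) (z : ℕ) where

  open Scaffold S

  lo hi : Subset m → Subset (suc z + m)
  lo A = ⊥ ++ A
  hi B = ⊤ ++ B

  𝓕 : List (Subset (suc z + m))
  𝓕 = map lo 𝒜 List.++ map hi ℬ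

  lo∈𝓕 : ∀ {A} → A ∈ 𝒜 → lo A ∈ 𝓕
  lo∈𝓕 A∈𝒜 = ∈-++⁺ˡ (∈-map⁺ lo A∈𝒜)

  hi∈𝓕 : ∀ {B} → B ∈ ℬ → hi B ∈ 𝓕
  hi∈𝓕 B∈ℬ = ∈-++⁺ʳ (map lo 𝒜) (∈-map⁺ hi B∈ℬ)

  data Member (T : Subset (suc z + m)) : Set where
    lower : ∀ {A} → A ∈ 𝒜 → T ≡ lo A → Member T
    upper : ∀ {B} → B ∈ ℬ → T ≡ hi B → Member T

  member : ∀ {T} → T ∈ 𝓕 → Member T
  member T∈𝓕 with ∈-++⁻ (map lo 𝒜) T∈𝓕
  ... | inj₁ T∈lo𝒜 = let _ , A∈𝒜 , T≡loA = ∈-map⁻ lo T∈lo𝒜 in lower A∈𝒜 T≡loA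
  ... | inj₂ T∈hiℬ = let _ , B∈ℬ , T≡hiB = ∈-map⁻ hi T∈hiℬ in upper B∈ℬ T≡hiB

  rank : Subset (suc z + m) → ℕ
  rank (outside ∷ T) = α (drop z T)
  rank (inside  ∷ T) = suc (α (drop z T))

  rank-lo : ∀ A → rank (lo A) ≡ α A
  rank-lo A = cong α (drop-++ (⊥ {z}) A)

  rank-hi : ∀ B → rank (hi B) ≡ suc (α B)
  rank-hi B = cong (λ X → suc (α X)) (drop-++ (⊤ {z}) B)

  rank<2+j : ∀ {T} → T ∈ 𝓕 → rank T < 2 + j
  rank<2+j T∈𝓕 with member T∈𝓕
  ... | lower {A} _ refl rewrite rank-lo A = s≤s (m≤n⇒m≤1+n (α≤j A))
  ... | upper {B} _ refl rewrite rank-hi B = s≤s (s≤s (α≤j B))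

  rank-strict : ∀ {T T′} → T ∈ 𝓕 → T′ ∈ 𝓕 → T ⊂ T′ → rank T < rank T′
  rank-strict T∈𝓕 T′∈𝓕 T⊂T′ with member T∈𝓕 | member T′∈𝓕
  ... | lower {A} A∈𝒜 refl | lower {A′} A′∈𝒜 refl rewrite rank-lo A | rank-lo A′ with ++⁻-⊂ ⊥ ⊥ T⊂T′
  ...   | inj₁ (⊥⊂⊥ , _)  = contradiction ⊥⊂⊥ (⊂-irref refl)
  ...   | inj₂ (_ , A⊂A′) = α-strict-𝒜 A∈𝒜 A′∈𝒜 A⊂A′
  rank-strict _ _ T⊂T′ | lower {A} A∈𝒜 refl | upper {B} B∈ℬ refl rewrite rank-lo A | rank-hi B =
    s≤s (α-mono-𝒜ℬ A∈𝒜 B∈ℬ (proj₂ (++⁻-⊆ ⊥ ⊤ (p⊂q⇒p⊆q T⊂T′))))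
  rank-strict _ _ T⊂T′ | upper _ refl | lower _ refl with p⊂q⇒p⊆q T⊂T′ Vec.here
  ... | ()
  rank-strict _ _ T⊂T′ | upper {B} B∈ℬ refl | upper {B′} B′∈ℬ refl rewrite rank-hi B | rank-hi B′ with ++⁻-⊂ ⊤ ⊤ T⊂T′
  ...   | inj₁ (⊤⊂⊤ , _)  = contradiction ⊤⊂⊤ (⊂-irref refl)
  ...   | inj₂ (_ , B⊂B′) = s≤s (α-strict-ℬ B∈ℬ B′∈ℬ B⊂B′)

  sperner : IsSperner (2 + j) 𝓕
  sperner = rank⇒IsSperner rank rank<2+j rank-strict

  lo⊂ : ∀ {T A} → T ∉ 𝓕 → A ∈ 𝒜 → A ⊆ drop (suc z) T → lo A ⊂ T
  lo⊂ {T} T∉𝓕 A∈𝒜 A⊆C = ⊆∧≢⇒⊂ (subst (_ ⊆_) (take++drop≡id (suc z) T) (++⁺-⊆ (⊆-min _) A⊆C))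
                              (λ loA≡T → T∉𝓕 (subst (_∈ 𝓕) loA≡T (lo∈𝓕 A∈𝒜)))

  ⊂hi : ∀ {T B} → T ∉ 𝓕 → B ∈ ℬ → drop (suc z) T ⊆ B → T ⊂ hi B
  ⊂hi {T} T∉𝓕 B∈ℬ C⊆B = ⊆∧≢⇒⊂ (subst (_⊆ _) (take++drop≡id (suc z) T) (++⁺-⊆ (⊆-max _) C⊆B))
                              (λ T≡hiB → T∉𝓕 (subst (_∈ 𝓕) (sym T≡hiB) (hi∈𝓕 B∈ℬ)))

  saturated : ∀ T → T ∉ 𝓕 → HasChain (2 + j) (T ∷ 𝓕)
  saturated T T∉𝓕 = linked⇒HasChain chain |chain| chain∈T∷𝓕
    (Linked-++-∷ (Linked.map⁺ (Linked.map (++⁺ʳ-⊂ ⊆-refl) (Linked-reverse ↓.linked)))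
                 (All.map⁺ (All.map (uncurry (lo⊂ T∉𝓕)) (All-reverse ↓.members)))
                 (All.map⁺ (All.map (uncurry (⊂hi T∉𝓕)) ↑.members))
                 (Linked.map⁺ (Linked.map (++⁺ʳ-⊂ ⊆-refl) ↑.linked)))
    where
    C = drop (suc z) T
    module ↓ = ChainIn (graded-chain 𝒜-graded (λ Y⊂X X⊆C → ⊆-trans (p⊂q⇒p⊆q Y⊂X) X⊆C) C)
    module ↑ = ChainIn (graded-chain ℬ-graded (λ Y⊃X X⊇C → ⊆-trans X⊇C (p⊂q⇒p⊆q Y⊃X)) C)

    lows highs chain : List (Subset (suc z + m))
    lows  = map lo (reverse ↓.sets)
    highs = map hi ↑.sets
    chain = lows List.++ T ∷ highs

    chain∈T∷𝓕 : All (_∈ T ∷ 𝓕) chain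
    chain∈T∷𝓕 = All.++⁺ (All.map⁺ (All.map (there ∘ lo∈𝓕 ∘ proj₁) (All-reverse ↓.members)))
                        (here refl ∷ All.map⁺ (All.map (there ∘ hi∈𝓕 ∘ proj₁) ↑.members))

    |chain| : length chain ≡ suc (2 + j)
    |chain| = begin
      length chain                       ≡⟨ length-++ lows ⟩
      length lows + suc (length highs)   ≡⟨ cong₂ (λ a b → a + suc b)
                                                  (trans (length-map lo (reverse ↓.sets)) (length-reverse ↓.sets))
                                                  (length-map hi ↑.sets) ⟩
      length ↓.sets + suc (length ↑.sets) ≡⟨ cong₂ (λ a b → a + suc b) ↓.length≡ ↑.length≡ ⟩
      suc (α C) + suc (suc (β C))        ≡⟨ cong suc (trans (+-suc (α C) (suc (β C))) (cong suc (+-suc (α C) (β C)))) ⟩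
      suc (suc (suc (α C + β C)))        ≡⟨ cong (3 +_) (α+β≡j C) ⟩
      suc (2 + j)                        ∎
      where open ≡-Reasoning

  unique : Unique 𝓕
  unique = Unique.++⁺ (Unique.map⁺ (++-injectiveʳ ⊥ ⊥) 𝒜-unique)
                      (Unique.map⁺ (++-injectiveʳ ⊤ ⊤) ℬ-unique) lo≢hi
    where
    lo≢hi : ∀ {T} → ¬ (T ∈ map lo 𝒜 × T ∈ map hi ℬ)
    lo≢hi (T∈lo𝒜 , T∈hiℬ) with ∈-map⁻ lo T∈lo𝒜 | ∈-map⁻ hi T∈hiℬ
    ... | _ , _ , refl | _ , _ , ()

  |𝓕|≡size : length 𝓕 ≡ size
  |𝓕|≡size = trans (length-++ (map lo 𝒜)) (cong₂ _+_ (length-map lo 𝒜) (length-map hi ℬ))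

scaffold⇒SatAtMost : (S : Scaffold j m) → m < n → SatAtMost n (2 + j) (_≡ Scaffold.size S)
scaffold⇒SatAtMost {j} {m} {n} S m<n = subst (λ n → SatAtMost n (2 + j) (_≡ size)) 1+z+m≡n
  (𝓕 , unique , (sperner , saturated) , |𝓕|≡size)
  where
  open Scaffold S using (size)
  z = n ∸ suc m
  open FromScaffold S z
  1+z+m≡n : suc z + m ≡ n
  1+z+m≡n = trans (sym (+-suc z m)) (m∸n+n≡m m<n)

-- Products of scaffolds

infixr 7 _⊠_
_⊠_ : List (Subset m₁) → List (Subset m₂) → List (Subset (m₁ + m₂))
_⊠_ = cartesianProductWith _++_

infixr 6 _⊕_
_⊕_ : (Subset m₁ → ℕ) → (Subset m₂ → ℕ) → Subset (m₁ + m₂) → ℕ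
_⊕_ {m₁} ρ₁ ρ₂ C = ρ₁ (take m₁ C) + ρ₂ (drop m₁ C)

⊕-++ : (ρ₁ : Subset m₁ → ℕ) (ρ₂ : Subset m₂ → ℕ) (X : Subset m₁) (Y : Subset m₂) →
       (ρ₁ ⊕ ρ₂) (X ++ Y) ≡ ρ₁ X + ρ₂ Y
⊕-++ ρ₁ ρ₂ X Y = cong₂ (λ X′ Y′ → ρ₁ X′ + ρ₂ Y′) (take-++ X Y) (drop-++ X Y)

length-⊠ : (𝒳 : List (Subset m₁)) (𝒴 : List (Subset m₂)) → length (𝒳 ⊠ 𝒴) ≡ length 𝒳 * length 𝒴
length-⊠ []      𝒴 = refl
length-⊠ (X ∷ 𝒳) 𝒴 = trans (length-++ (map (X ++_) 𝒴)) (cong₂ _+_ (length-map (X ++_) 𝒴) (length-⊠ 𝒳 𝒴))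

∈-⊠⁻ : (𝒳 : List (Subset m₁)) (𝒴 : List (Subset m₂)) {Z : Subset (m₁ + m₂)} →
       Z ∈ 𝒳 ⊠ 𝒴 → ∃₂ λ X Y → X ∈ 𝒳 × Y ∈ 𝒴 × Z ≡ X ++ Y
∈-⊠⁻ = ∈-cartesianProductWith⁻ _++_

m+n>0⇒m>0⊎n>0 : ∀ a {b} → 0 < a + b → 0 < a ⊎ 0 < b
m+n>0⇒m>0⊎n>0 zero    0<b = inj₂ 0<b
m+n>0⇒m>0⊎n>0 (suc a) _   = inj₁ (s≤s z≤n)

module _ (_≼_ _≺_ : ∀ {m} → Rel (Subset m) 0ℓ)
         (++⁺-≼  : ∀ {m₁ m₂} {p q : Subset m₁} {r s : Subset m₂} → p ≼ q → r ≼ s → (p ++ r) ≼ (q ++ s))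
         (++⁺ˡ-≺ : ∀ {m₁ m₂} {p q : Subset m₁} {r : Subset m₂} → p ≺ q → (p ++ r) ≺ (q ++ r))
         (++⁺ʳ-≺ : ∀ {m₁ m₂} {p : Subset m₁} {r s : Subset m₂} → r ≺ s → (p ++ r) ≺ (p ++ s))
         {𝒳₁ : List (Subset m₁)} {𝒳₂ : List (Subset m₂)} {ρ₁ : Subset m₁ → ℕ} {ρ₂ : Subset m₂ → ℕ}
         where

  Graded-⊠ : Graded _≼_ _≺_ 𝒳₁ ρ₁ → Graded _≼_ _≺_ 𝒳₂ ρ₂ → Graded _≼_ _≺_ (𝒳₁ ⊠ 𝒳₂) (ρ₁ ⊕ ρ₂)
  Graded-⊠ g₁ g₂ = record { cover = cover ; step = step }
    where
    module G₁ = Graded g₁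
    module G₂ = Graded g₂
    open ≡-Reasoning

    cover : ∀ C → ∃[ X ] X ∈ 𝒳₁ ⊠ 𝒳₂ × X ≼ C × (ρ₁ ⊕ ρ₂) X ≡ (ρ₁ ⊕ ρ₂) C
    cover C with G₁.cover (take m₁ C) | G₂.cover (drop m₁ C)
    ... | X₁ , X₁∈𝒳₁ , X₁≼ , ρX₁≡ | X₂ , X₂∈𝒳₂ , X₂≼ , ρX₂≡ =
      X₁ ++ X₂ , ∈-cartesianProductWith⁺ _++_ X₁∈𝒳₁ X₂∈𝒳₂ ,
      subst ((X₁ ++ X₂) ≼_) (take++drop≡id m₁ C) (++⁺-≼ X₁≼ X₂≼) ,
      trans (⊕-++ ρ₁ ρ₂ X₁ X₂) (cong₂ _+_ ρX₁≡ ρX₂≡)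

    step : ∀ {X} → X ∈ 𝒳₁ ⊠ 𝒳₂ → 0 < (ρ₁ ⊕ ρ₂) X →
           ∃[ Y ] Y ∈ 𝒳₁ ⊠ 𝒳₂ × Y ≺ X × suc ((ρ₁ ⊕ ρ₂) Y) ≡ (ρ₁ ⊕ ρ₂) X
    step X∈ 0<ρX with ∈-⊠⁻ 𝒳₁ 𝒳₂ X∈
    ... | X₁ , X₂ , X₁∈𝒳₁ , X₂∈𝒳₂ , refl
      with m+n>0⇒m>0⊎n>0 (ρ₁ X₁) (subst (0 <_) (⊕-++ ρ₁ ρ₂ X₁ X₂) 0<ρX)
    ...   | inj₁ 0<ρX₁ = let Y₁ , Y₁∈𝒳₁ , Y₁≺X₁ , 1+ρY₁≡ρX₁ = G₁.step X₁∈𝒳₁ 0<ρX₁ in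
      Y₁ ++ X₂ , ∈-cartesianProductWith⁺ _++_ Y₁∈𝒳₁ X₂∈𝒳₂ , ++⁺ˡ-≺ Y₁≺X₁ , (begin
        suc ((ρ₁ ⊕ ρ₂) (Y₁ ++ X₂)) ≡⟨ cong suc (⊕-++ ρ₁ ρ₂ Y₁ X₂) ⟩
        suc (ρ₁ Y₁) + ρ₂ X₂        ≡⟨ cong (_+ ρ₂ X₂) 1+ρY₁≡ρX₁ ⟩
        ρ₁ X₁ + ρ₂ X₂              ≡⟨ ⊕-++ ρ₁ ρ₂ X₁ X₂ ⟨
        (ρ₁ ⊕ ρ₂) (X₁ ++ X₂)       ∎)
    ...   | inj₂ 0<ρX₂ = let Y₂ , Y₂∈𝒳₂ , Y₂≺X₂ , 1+ρY₂≡ρX₂ = G₂.step X₂∈𝒳₂ 0<ρX₂ in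
      X₁ ++ Y₂ , ∈-cartesianProductWith⁺ _++_ X₁∈𝒳₁ Y₂∈𝒳₂ , ++⁺ʳ-≺ Y₂≺X₂ , (begin
        suc ((ρ₁ ⊕ ρ₂) (X₁ ++ Y₂)) ≡⟨ cong suc (⊕-++ ρ₁ ρ₂ X₁ Y₂) ⟩
        suc (ρ₁ X₁ + ρ₂ Y₂)        ≡⟨ +-suc (ρ₁ X₁) (ρ₂ Y₂) ⟨
        ρ₁ X₁ + suc (ρ₂ Y₂)        ≡⟨ cong (ρ₁ X₁ +_) 1+ρY₂≡ρX₂ ⟩
        ρ₁ X₁ + ρ₂ X₂              ≡⟨ ⊕-++ ρ₁ ρ₂ X₁ X₂ ⟨
        (ρ₁ ⊕ ρ₂) (X₁ ++ X₂)       ∎)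

strictlyMonotone⇒monotone : {𝒳 : List (Subset m)} {ρ : Subset m → ℕ} → StrictlyMonotoneOn 𝒳 ρ →
                            ∀ {X Y} → X ∈ 𝒳 → Y ∈ 𝒳 → X ⊆ Y → ρ X ≤ ρ Y
strictlyMonotone⇒monotone ρ↗ X∈𝒳 Y∈𝒳 X⊆Y with ⊆⇒≡⊎⊂ X⊆Y
... | inj₁ refl = ≤-refl
... | inj₂ X⊂Y  = <⇒≤ (ρ↗ X∈𝒳 Y∈𝒳 X⊂Y)

StrictlyMonotoneOn-⊠ : {𝒳₁ : List (Subset m₁)} {𝒳₂ : List (Subset m₂)} {ρ₁ : Subset m₁ → ℕ} {ρ₂ : Subset m₂ → ℕ} →
                       StrictlyMonotoneOn 𝒳₁ ρ₁ → StrictlyMonotoneOn 𝒳₂ ρ₂ → StrictlyMonotoneOn (𝒳₁ ⊠ 𝒳₂) (ρ₁ ⊕ ρ₂)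
StrictlyMonotoneOn-⊠ {𝒳₁ = 𝒳₁} {𝒳₂} {ρ₁} {ρ₂} ρ₁↗ ρ₂↗ X∈ Y∈ X⊂Y with ∈-⊠⁻ 𝒳₁ 𝒳₂ X∈ | ∈-⊠⁻ 𝒳₁ 𝒳₂ Y∈
... | X₁ , X₂ , X₁∈ , X₂∈ , refl | Y₁ , Y₂ , Y₁∈ , Y₂∈ , refl =
  subst₂ _<_ (sym (⊕-++ ρ₁ ρ₂ X₁ X₂)) (sym (⊕-++ ρ₁ ρ₂ Y₁ Y₂)) (componentwise (++⁻-⊂ X₁ Y₁ X⊂Y))
  where
  componentwise : X₁ ⊂ Y₁ × X₂ ⊆ Y₂ ⊎ X₁ ⊆ Y₁ × X₂ ⊂ Y₂ → ρ₁ X₁ + ρ₂ X₂ < ρ₁ Y₁ + ρ₂ Y₂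
  componentwise (inj₁ (X₁⊂Y₁ , X₂⊆Y₂)) =
    +-mono-<-≤ (ρ₁↗ X₁∈ Y₁∈ X₁⊂Y₁) (strictlyMonotone⇒monotone ρ₂↗ X₂∈ Y₂∈ X₂⊆Y₂)
  componentwise (inj₂ (X₁⊆Y₁ , X₂⊂Y₂)) =
    +-mono-≤-< (strictlyMonotone⇒monotone ρ₁↗ X₁∈ Y₁∈ X₁⊆Y₁) (ρ₂↗ X₂∈ Y₂∈ X₂⊂Y₂)

_⊗_ : Scaffold j₁ m₁ → Scaffold j₂ m₂ → Scaffold (j₁ + j₂) (m₁ + m₂)
_⊗_ {m₁ = m₁} S₁ S₂ = record
  { 𝒜          = S₁.𝒜 ⊠ S₂.𝒜
  ; ℬ          = S₁.ℬ ⊠ S₂.ℬ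
  ; 𝒜-unique   = Unique.cartesianProductWith⁺ _++_ ++-injective S₁.𝒜-unique S₂.𝒜-unique
  ; ℬ-unique   = Unique.cartesianProductWith⁺ _++_ ++-injective S₁.ℬ-unique S₂.ℬ-unique
  ; α          = S₁.α ⊕ S₂.α
  ; β          = S₁.β ⊕ S₂.β
  ; α+β≡j      = λ C → trans (interchange +-commutativeSemigroup (S₁.α _) (S₂.α _) (S₁.β _) (S₂.β _))
                              (cong₂ _+_ (S₁.α+β≡j (take m₁ C)) (S₂.α+β≡j (drop m₁ C)))
  ; 𝒜-graded   = Graded-⊠ _⊆_ _⊂_ ++⁺-⊆ (flip ++⁺ˡ-⊂ ⊆-refl) (++⁺ʳ-⊂ ⊆-refl) S₁.𝒜-graded S₂.𝒜-graded
  ; ℬ-graded   = Graded-⊠ _⊇_ _⊃_ ++⁺-⊆ (flip ++⁺ˡ-⊂ ⊆-refl) (++⁺ʳ-⊂ ⊆-refl) S₁.ℬ-graded S₂.ℬ-graded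
  ; α-strict-𝒜 = StrictlyMonotoneOn-⊠ S₁.α-strict-𝒜 S₂.α-strict-𝒜
  ; α-strict-ℬ = StrictlyMonotoneOn-⊠ S₁.α-strict-ℬ S₂.α-strict-ℬ
  ; α-mono-𝒜ℬ  = α-mono-𝒜ℬ
  }
  where
  module S₁ = Scaffold S₁
  module S₂ = Scaffold S₂

  ++-injective : ∀ {w x : Subset m₁} {y z : Subset m₂} → w ++ y ≡ x ++ z → w ≡ x × y ≡ z
  ++-injective {w = w} {x} w++y≡x++z = ++-injectiveˡ w x w++y≡x++z , ++-injectiveʳ w x w++y≡x++z

  α-mono-𝒜ℬ : ∀ {A} → A ∈ S₁.𝒜 ⊠ S₂.𝒜 → ∀ {B} → B ∈ S₁.ℬ ⊠ S₂.ℬ → A ⊆ B → (S₁.α ⊕ S₂.α) A ≤ (S₁.α ⊕ S₂.α) B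
  α-mono-𝒜ℬ A∈ B∈ A⊆B with ∈-⊠⁻ S₁.𝒜 S₂.𝒜 A∈ | ∈-⊠⁻ S₁.ℬ S₂.ℬ B∈
  ... | A₁ , A₂ , A₁∈ , A₂∈ , refl | B₁ , B₂ , B₁∈ , B₂∈ , refl =
    let A₁⊆B₁ , A₂⊆B₂ = ++⁻-⊆ A₁ B₁ A⊆B in
    subst₂ _≤_ (sym (⊕-++ S₁.α S₂.α A₁ A₂)) (sym (⊕-++ S₁.α S₂.α B₁ B₂))
      (+-mono-≤ (S₁.α-mono-𝒜ℬ A₁∈ B₁∈ A₁⊆B₁) (S₂.α-mono-𝒜ℬ A₂∈ B₂∈ A₂⊆B₂))

-- Scaffolds certified by computation

∀-Subset? : {P : Subset m → Set} → U.Decidable P → Dec (∀ C → P C)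
∀-Subset? {m = zero}  P? = map′ (λ { P[] [] → P[] }) (λ ∀P → ∀P []) (P? [])
∀-Subset? {m = suc m} P? =
  map′ (λ { (Pin , Pout) (inside ∷ C) → Pin C ; (Pin , Pout) (outside ∷ C) → Pout C })
       (λ ∀P → ∀P ∘ (inside ∷_) , ∀P ∘ (outside ∷_))
       (∀-Subset? (P? ∘ (inside ∷_)) ×-dec ∀-Subset? (P? ∘ (outside ∷_)))

∃∈? : {P : A → Set} → U.Decidable P → (xs : List A) → Dec (∃[ x ] x ∈ xs × P x)
∃∈? P? xs = map′ find (λ (_ , x∈xs , px) → lose x∈xs px) (any? P? xs)

∀∈? : {P : A → Set} → U.Decidable P → (xs : List A) → Dec (∀ {x} → x ∈ xs → P x)
∀∈? P? xs = map′ All.lookup All.tabulate (all? P? xs)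

module _ {_≼_ _≺_ : Rel (Subset m) 0ℓ} (_≼?_ : Decidable _≼_) (_≺?_ : Decidable _≺_)
         (𝒳 : List (Subset m)) (ρ : Subset m → ℕ) where

  private
    Cover Step : Set
    Cover = ∀ C → ∃[ X ] X ∈ 𝒳 × X ≼ C × ρ X ≡ ρ C
    Step  = ∀ {X} → X ∈ 𝒳 → 0 < ρ X → ∃[ Y ] Y ∈ 𝒳 × Y ≺ X × suc (ρ Y) ≡ ρ X

    toGraded : Cover × Step → Graded _≼_ _≺_ 𝒳 ρ
    toGraded (cover , step) = record { cover = cover ; step = step }

    fromGraded : Graded _≼_ _≺_ 𝒳 ρ → Cover × Step
    fromGraded graded = Graded.cover graded , Graded.step graded

  graded? : Dec (Graded _≼_ _≺_ 𝒳 ρ)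
  graded? = map′ toGraded fromGraded
    (∀-Subset? (λ C → ∃∈? (λ X → X ≼? C ×-dec ρ X ≟ ρ C) 𝒳) ×-dec
     ∀∈? (λ X → 0 <? ρ X →-dec ∃∈? (λ Y → Y ≺? X ×-dec suc (ρ Y) ≟ ρ X) 𝒳) 𝒳)

strictlyMonotoneOn? : (𝒳 : List (Subset m)) (ρ : Subset m → ℕ) → Dec (StrictlyMonotoneOn 𝒳 ρ)
strictlyMonotoneOn? 𝒳 ρ = ∀∈? (λ X → ∀∈? (λ Y → X ⊂? Y →-dec ρ X <? ρ Y) 𝒳) 𝒳

largestInside : List (Subset m) → Subset m → ℕ
largestInside 𝒜 C = foldr _⊔_ 0 (map ∣_∣ (filter (_⊆? C) 𝒜))

module Certified {m} (j : ℕ) (𝒜 ℬ : List (Subset m)) where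

  α β : Subset m → ℕ
  α = largestInside 𝒜
  β C = j ∸ α C

  Conditions : Set
  Conditions = Unique 𝒜 × Unique ℬ × (∀ C → α C ≤ j) ×
               Graded _⊆_ _⊂_ 𝒜 α × Graded _⊇_ _⊃_ ℬ β ×
               StrictlyMonotoneOn 𝒜 α × StrictlyMonotoneOn ℬ α ×
               (∀ {A} → A ∈ 𝒜 → ∀ {B} → B ∈ ℬ → A ⊆ B → α A ≤ α B)

  conditions? : Dec Conditions
  conditions? =
    UniqueDec.unique? _≟ₛ_ 𝒜 ×-dec UniqueDec.unique? _≟ₛ_ ℬ ×-dec ∀-Subset? (λ C → α C ≤? j) ×-dec
    graded? _⊆?_ _⊂?_ 𝒜 α ×-dec graded? (flip _⊆?_) (flip _⊂?_) ℬ β ×-dec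
    strictlyMonotoneOn? 𝒜 α ×-dec strictlyMonotoneOn? ℬ α ×-dec
    ∀∈? (λ A → ∀∈? (λ B → A ⊆? B →-dec α A ≤? α B) ℬ) 𝒜

  scaffold : True conditions? → Scaffold j m
  scaffold ok =
    let 𝒜-unique , ℬ-unique , α≤j , 𝒜-graded , ℬ-graded , α-strict-𝒜 , α-strict-ℬ , α-mono-𝒜ℬ = toWitness ok in
    record
      { 𝒜 = 𝒜 ; ℬ = ℬ ; 𝒜-unique = 𝒜-unique ; ℬ-unique = ℬ-unique ; α = α ; β = β
      ; α+β≡j = λ C → m+[n∸m]≡n (α≤j C) ; 𝒜-graded = 𝒜-graded ; ℬ-graded = ℬ-graded
      ; α-strict-𝒜 = α-strict-𝒜 ; α-strict-ℬ = α-strict-ℬ ; α-mono-𝒜ℬ = α-mono-𝒜ℬ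
      }

elements : List ℕ → Subset m
elements xs = tabulate (λ i → any (toℕ i ≡ᵇ_) xs)

scaffold₀ : Scaffold 0 0
scaffold₀ = Certified.scaffold 0 ([] ∷ []) ([] ∷ []) tt

scaffold₁ : Scaffold 1 1
scaffold₁ = Certified.scaffold 1 𝒫[1] 𝒫[1] tt
  where 𝒫[1] = map elements ([] ∷ (0 ∷ []) ∷ [])

scaffold₄ : Scaffold 4 6
scaffold₄ = Certified.scaffold 4 𝒜 ℬ tt
  where
  𝒜 ℬ : List (Subset 6)
  𝒜 = map elements
    ( [] ∷ (2 ∷ []) ∷ (0 ∷ 2 ∷ []) ∷ (1 ∷ 2 ∷ []) ∷ (3 ∷ []) ∷ (0 ∷ 3 ∷ []) ∷ (1 ∷ 3 ∷ []) ∷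
      (0 ∷ 2 ∷ 3 ∷ []) ∷ (1 ∷ 2 ∷ 3 ∷ []) ∷ (0 ∷ 1 ∷ 2 ∷ 3 ∷ []) ∷
      (4 ∷ []) ∷ (5 ∷ []) ∷ (4 ∷ 5 ∷ []) ∷ (0 ∷ 4 ∷ 5 ∷ []) ∷ (1 ∷ 4 ∷ 5 ∷ []) ∷ [] )
  ℬ = map elements
    ( (0 ∷ 1 ∷ []) ∷ (0 ∷ 1 ∷ 4 ∷ []) ∷ (0 ∷ 1 ∷ 2 ∷ 4 ∷ []) ∷ (0 ∷ 1 ∷ 3 ∷ 4 ∷ []) ∷ (2 ∷ 3 ∷ 4 ∷ []) ∷
      (0 ∷ 1 ∷ 5 ∷ []) ∷ (0 ∷ 1 ∷ 2 ∷ 5 ∷ []) ∷ (0 ∷ 1 ∷ 3 ∷ 5 ∷ []) ∷ (2 ∷ 3 ∷ 5 ∷ []) ∷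
      (0 ∷ 1 ∷ 2 ∷ 4 ∷ 5 ∷ []) ∷ (0 ∷ 1 ∷ 3 ∷ 4 ∷ 5 ∷ []) ∷ (2 ∷ 3 ∷ 4 ∷ 5 ∷ []) ∷
      (0 ∷ 2 ∷ 3 ∷ 4 ∷ 5 ∷ []) ∷ (1 ∷ 2 ∷ 3 ∷ 4 ∷ 5 ∷ []) ∷ (0 ∷ 1 ∷ 2 ∷ 3 ∷ 4 ∷ 5 ∷ []) ∷ [] )

-- Size bounds

Bounded : Scaffold j m → ℕ → Set
Bounded S c = length (Scaffold.𝒜 S) ≤ c × length (Scaffold.ℬ S) ≤ c

⊗-bounded : ∀ {c₁ c₂} (S₁ : Scaffold j₁ m₁) (S₂ : Scaffold j₂ m₂) →
            Bounded S₁ c₁ → Bounded S₂ c₂ → Bounded (S₁ ⊗ S₂) (c₁ * c₂)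
⊗-bounded S₁ S₂ (𝒜₁≤ , ℬ₁≤) (𝒜₂≤ , ℬ₂≤) =
  subst (_≤ _) (sym (length-⊠ (Scaffold.𝒜 S₁) (Scaffold.𝒜 S₂))) (*-mono-≤ 𝒜₁≤ 𝒜₂≤) ,
  subst (_≤ _) (sym (length-⊠ (Scaffold.ℬ S₁) (Scaffold.ℬ S₂))) (*-mono-≤ ℬ₁≤ ℬ₂≤)

^-distribʳ-* : ∀ x y n → (x * y) ^ n ≡ x ^ n * y ^ n
^-distribʳ-* x y zero    = refl
^-distribʳ-* x y (suc n) =
  trans (cong (x * y *_) (^-distribʳ-* x y n)) (interchange *-commutativeSemigroup x y (x ^ n) (y ^ n))

^-*-≤-2^ : ∀ {x y p q r} → x ^ p ≤ 2 ^ q → y ^ p ≤ 2 ^ r → (x * y) ^ p ≤ 2 ^ (q + r)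
^-*-≤-2^ {x} {y} {p} {q} {r} x^p≤2^q y^p≤2^r =
  subst₂ _≤_ (sym (^-distribʳ-* x y p)) (sym (^-distribˡ-+-* 2 q r)) (*-mono-≤ x^p≤2^q y^p≤2^r)

15^43≤2^168 : 15 ^ 43 ≤ 2 ^ (42 * 4)
15^43≤2^168 = toWitness {a? = 15 ^ 43 ≤? 2 ^ (42 * 4)} tt

-- The exponent is written 42 * suc (suc j), not 42 * (2 + j), to match the goal syntactically:
-- comparing two different exponents makes the type checker unfold 2 ^ _.
record SmallScaffold (j : ℕ) : Set where
  field
    c        : ℕ
    c-small  : (2 * c) ^ 43 ≤ 2 ^ (42 * suc (suc j))
    points   : ℕ
    scaffold : Scaffold j points
    bounded  : Bounded scaffold c

scaffold₄-⊗ : SmallScaffold j → SmallScaffold (4 + j)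
scaffold₄-⊗ {j} S = record
  { c        = 15 * c
  -- 15 ^ 43 is evaluated to a numeral, from which x and p could not be inferred.
  ; c-small  = subst₂ (λ x e → x ^ 43 ≤ 2 ^ e) 15*2c≡2*15c 168+42[2+j]≡42[6+j]
                      (^-*-≤-2^ {15} {2 * c} {43} {42 * 4} {42 * suc (suc j)} 15^43≤2^168 c-small)
  ; points   = 6 + points
  ; scaffold = scaffold₄ ⊗ scaffold
  ; bounded  = ⊗-bounded scaffold₄ scaffold (≤-refl , ≤-refl) bounded
  }
  where
  open SmallScaffold S
  15*2c≡2*15c : 15 * (2 * c) ≡ 2 * (15 * c)
  15*2c≡2*15c = trans (sym (*-assoc 15 2 c)) (trans (cong (_* c) (*-comm 15 2)) (*-assoc 2 15 c))
  168+42[2+j]≡42[6+j] : 42 * 4 + 42 * suc (suc j) ≡ 42 * suc (suc (4 + j))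
  168+42[2+j]≡42[6+j] = sym (*-distribˡ-+ 42 4 (suc (suc j)))

small-scaffold : ∀ j → SmallScaffold j
small-scaffold 0 = record
  { c = 1 ; c-small = toWitness {a? = _ ≤? _} tt ; points = 0 ; scaffold = scaffold₀ ; bounded = ≤-refl , ≤-refl }
small-scaffold 1 = record
  { c = 2 ; c-small = toWitness {a? = _ ≤? _} tt ; points = 1 ; scaffold = scaffold₁ ; bounded = ≤-refl , ≤-refl }
small-scaffold 2 = record
  { c = 4 ; c-small = toWitness {a? = _ ≤? _} tt ; points = 2 ; scaffold = scaffold₁ ⊗ scaffold₁
  ; bounded = ≤-refl , ≤-refl }
small-scaffold 3 = record
  { c = 8 ; c-small = toWitness {a? = _ ≤? _} tt ; points = 3 ; scaffold = scaffold₁ ⊗ (scaffold₁ ⊗ scaffold₁)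
  ; bounded = ≤-refl , ≤-refl }
small-scaffold (suc (suc (suc (suc j)))) = scaffold₄-⊗ (small-scaffold j)

SatAtMost-1 : ∀ n → SatAtMost n 1 (_≡ 1)
SatAtMost-1 n = ⊥ ∷ [] , [] ∷ [] , (sperner , saturated) , refl
  where
  sperner : IsSperner 1 (⊥ ∷ [])
  sperner = rank⇒IsSperner (λ _ → 0) (λ _ → s≤s z≤n)
    (λ { (here refl) (here refl) ⊥⊂⊥ → contradiction ⊥⊂⊥ (⊂-irref refl) })
  saturated : ∀ S → S ∉ ⊥ ∷ [] → HasChain 1 (S ∷ ⊥ ∷ [])
  saturated S S∉ = linked⇒HasChain (⊥ ∷ S ∷ []) refl (there (here refl) ∷ here refl ∷ [])
    (⊆∧≢⇒⊂ (⊆-min S) (λ ⊥≡S → S∉ (here (sym ⊥≡S))) ∷ [-])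

SatAtMost-≡ : ∀ {s} {P : ℕ → Set} → SatAtMost n k (_≡ s) → P s → SatAtMost n k P
SatAtMost-≡ {P = P} (𝓕 , unique , saturated , |𝓕|≡s) Ps = 𝓕 , unique , saturated , subst P (sym |𝓕|≡s) Ps

theorem1p3 : Σ ℕ λ a → Σ ℕ λ b → 0 < a × a < b ×
    (∀ (k : ℕ) → 1 ≤ k → Σ ℕ λ N → ∀ (n : ℕ) → N ≤ n →
    SatAtMost n k (λ s → s ^ b ≤ 2 ^ ((b ∸ a) * k)))
theorem1p3 = 1 , 43 , s≤s z≤n , s≤s (s≤s z≤n) , sat
  where
  Small : ℕ → ℕ → Set
  Small k s = s ^ 43 ≤ 2 ^ (42 * k)

  sat : ∀ k → 1 ≤ k → Σ ℕ λ N → ∀ n → N ≤ n → SatAtMost n k (Small k)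
  sat 1             _ = 0 , λ n _ → SatAtMost-≡ {P = Small 1} (SatAtMost-1 n) (s≤s z≤n)
  sat (suc (suc j)) _ = suc points , λ n points<n →
    SatAtMost-≡ {P = Small (2 + j)} (scaffold⇒SatAtMost scaffold points<n) (≤-trans (^-monoˡ-≤ 43 size≤2c) c-small)
    where
    open SmallScaffold (small-scaffold j)
    size≤2c : Scaffold.size scaffold ≤ 2 * c
    size≤2c = subst (Scaffold.size scaffold ≤_) (cong (c +_) (sym (+-identityʳ c)))
                    (+-mono-≤ (proj₁ bounded) (proj₂ bounded))
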